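{- Let $X=(V,E)$ be a digraph with vertices labeled $v_1,\ldots,v_n$ that is not a bag of sticks. Then \[W_X=\sum_{S\in\mathrm{Min}(\mathcal{E}_X)}(-1)^{|E|-|S|}\xi([S,E])\,W_{(V,S)},\] where $(V,S)$ carries the labeling of $X$, and consequently \[U_X=\sum_{S\in\mathrm{Min}(\mathcal{E}_X)}(-1)^{|E|-|S|}\xi([S,E])\,U_{P_{\lambda(S)}}.\]
   Context: A bag of sticks is a digraph that is a vertex-disjoint union of directed paths (paths with no edges, i.e. isolated vertices, allowed); for an integer partition $\lambda=(\lambda_1,\ldots,\lambda_k)$, $P_\lambda$ is the bag of sticks consisting of directed paths with $\lambda_1,\ldots,\lambda_k$ vertices; if $(V,S)$ is a bag of sticks isomorphic to $P_\lambda$, write $\lambda(S)=\lambda$. The edge poset $\mathcal{E}_X$ is the poset on the set of all subsets of $E$ with $A<B$ iff $A\subsetneq B$ and $(V,B)$ is not a bag of sticks; $\mathrm{Min}(\mathcal{E}_X)$ is its set of minimal elements and $[S,E]$ the interval from $S$ to $E$ in $\mathcal{E}_X$. For a poset $Q$ with unique minimum $0_Q$ and maximum $1_Q$, $\xi(Q)=\sum_c(-1)^{|c|-1}$, summed over all chains $c$ in $Q$ from $0_Q$ to $1_Q$ (containing both). For a digraph $Y=(V,F)$ with labeled vertices $v_1,\ldots,v_n$ and $f:V\to\mathbb{N}$, a listing $\sigma$ of $V$ is $(f,Y)$-friendly if $f(\sigma_1)\le\cdots\le f(\sigma_n)$ with strict inequality whenever $(\sigma_j,\sigma_{j+1})\in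 F$; $W_Y=\sum_f\#\{(f,Y)\text{ -friendly listings}\}\,x_{f(v_1)}\cdots x_{f(v_n)}$ in noncommuting variables. $U_Y$ is obtained from $W_Y$ by letting the variables commute; equivalently $U_Y=\sum_\sigma F_{Y\mathrm{Des}(\sigma)}$ over listings $\sigma$ of $V$, $Y\mathrm{Des}(\sigma)=\{i:(\sigma_i,\sigma_{i+1})\in F\}$, $F_I$ fundamental quasisymmetric functions. -}

module Defs where

open import Data.Bool using (Bool; true; false; _∧_; _∨_; not; if_then_else_; T)
open import Data.Nat using (ℕ; zero; suc; _+_; _∸_; _≤ᵇ_; _<ᵇ_; _≡ᵇ_; _≥_; _<_)
open import Data.Fin using (Fin; toℕ)
import Data.Fin as F
open import Data.List using (List; []; _∷_; map; length; filterᵇ; allFin; foldr; concatMap; deduplicate; upTo)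
import Data.List as L
open import Data.Bool.ListAction using (all; any)
open import Data.List.Relation.Unary.All using (All)
open import Data.List.Relation.Unary.Linked using (Linked)
open import Data.Vec using (Vec; lookup; toList)
import Data.Vec as V
open import Data.Vec.Properties using (≡-dec)
open import Data.Integer using (ℤ; +_; -_; _*_)
import Data.Integer as Z
open import Data.Product using (_×_; _,_; ∃)
open import Relation.Nullary.Decidable using (⌊_⌋)
open import Relation.Binary.PropositionalEquality using (_≡_)

vecsOver : {A : Set} → List A → (m : ℕ) → List (Vec A m)
vecsOver xs zero    = V.[] ∷ []
vecsOver xs (suc m) = concatMap (λ x → map (x V.∷_) (vecsOver xs m)) xs

sumℕ : List ℕ → ℕ
sumℕ = foldr _+_ 0

sumℤ : List ℤ → ℤ
sumℤ = foldr Z._+_ (+ 0)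

negOnePow : ℕ → ℤ
negOnePow zero    = + 1
negOnePow (suc k) = - negOnePow k

consecPairs : {A : Set} → List A → List (A × A)
consecPairs []           = []
consecPairs (x ∷ [])     = []
consecPairs (x ∷ y ∷ xs) = (x , y) ∷ consecPairs (y ∷ xs)

-- Digraphs on the labelled vertex set V = Fin n  (vertex v_i is i).
-- An edge set is a Boolean adjacency matrix: (i , j) ∈ A iff edge A i j ≡ true.

Edges : ℕ → Set
Edges n = Vec (Vec Bool n) n

edge : {n : ℕ} → Edges n → Fin n → Fin n → Bool
edge A i j = lookup (lookup A i) j

allEdgeSets : (n : ℕ) → List (Edges n)
allEdgeSets n = vecsOver (vecsOver (true ∷ false ∷ []) n) n

eqEdges : {n : ℕ} → Edges n → Edges n → Bool
eqEdges A B = ⌊ ≡-dec (≡-dec Data.Bool._≟_) A B ⌋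

pairs : (n : ℕ) → List (Fin n × Fin n)
pairs n = concatMap (λ i → map (i ,_) (allFin n)) (allFin n)

card : {n : ℕ} → Edges n → ℕ
card {n} A = length (filterᵇ (λ { (i , j) → edge A i j }) (pairs n))

subsetᵇ : {n : ℕ} → Edges n → Edges n → Bool
subsetᵇ {n} A B = all (λ { (i , j) → not (edge A i j) ∨ edge B i j }) (pairs n)

strictSubsetᵇ : {n : ℕ} → Edges n → Edges n → Bool
strictSubsetᵇ A B = subsetᵇ A B ∧ not (eqEdges A B)

subsetsOf : {n : ℕ} → Edges n → List (Edges n)
subsetsOf {n} E = filterᵇ (λ A → subsetᵇ A E) (allEdgeSets n)

injectiveᵇ : {n : ℕ} → Vec (Fin n) n → Bool
injectiveᵇ {n} σ =
  all (λ { (i , j) → ⌊ i F.≟ j ⌋ ∨ not ⌊ lookup σ i F.≟ lookup σ j ⌋ }) (pairs n)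

listings : (n : ℕ) → List (Vec (Fin n) n)
listings n = filterᵇ injectiveᵇ (vecsOver (allFin n) n)

memPairᵇ : {n : ℕ} → Fin n × Fin n → List (Fin n × Fin n) → Bool
memPairᵇ (i , j) = any (λ { (k , l) → ⌊ i F.≟ k ⌋ ∧ ⌊ j F.≟ l ⌋ })

-- (V , B) is a bag of sticks (vertex-disjoint union of directed paths,
-- isolated vertices allowed) iff the vertices can be listed path after path,
-- each path in its direction, i.e. iff there is a listing σ of V such that
-- every edge of B is a consecutive pair (σ_i , σ_{i+1}).
isBagᵇ : {n : ℕ} → Edges n → Bool
isBagᵇ {n} B =
  any (λ σ → all (λ { (i , j) → not (edge B i j) ∨ memPairᵇ (i , j) (consecPairs (toList σ)) })
                 (pairs n))
      (listings n)

friendlyᵇ : {n : ℕ} → (Fin n → ℕ) → Edges n → Vec (Fin n) n → Bool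
friendlyᵇ f Y σ =
  all (λ { (u , v) → if edge Y u v then f u <ᵇ f v else f u ≤ᵇ f v })
      (consecPairs (toList σ))

-- coefficient of the word x_{f(v_1)} ⋯ x_{f(v_n)} in W_Y
coeffW : {n : ℕ} → Edges n → (Fin n → ℕ) → ℕ
coeffW {n} Y f = length (filterᵇ (friendlyᵇ f Y) (listings n))

rearrangements : {n : ℕ} → Vec ℕ n → List (Vec ℕ n)
rearrangements {n} a =
  deduplicate (≡-dec Data.Nat._≟_) (map (λ σ → V.map (lookup a) σ) (listings n))

-- coefficient of the commutative monomial x_{a_1} ⋯ x_{a_n} in U_Y
-- (sum of the coefficients in W_Y of all words with the same content)
coeffU : {n : ℕ} → Edges n → Vec ℕ n → ℕ
coeffU Y a = sumℕ (map (λ w → coeffW Y (lookup w)) (rearrangements a))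

ltᵇ : {n : ℕ} → Edges n → Edges n → Bool
ltᵇ A B = strictSubsetᵇ A B ∧ not (isBagᵇ B)

minimals : {n : ℕ} → Edges n → List (Edges n)
minimals E = filterᵇ (λ S → all (λ T → not (ltᵇ T S)) (subsetsOf E)) (subsetsOf E)

-- number of chains  T = T_0 < T_1 < ⋯ < T_k = E  in 𝓔_X  (k+1 elements)
chainCount : {n : ℕ} → Edges n → ℕ → Edges n → ℕ
chainCount E zero    T = if eqEdges T E then 1 else 0
chainCount E (suc k) T =
  sumℕ (map (chainCount E k) (filterᵇ (λ U → ltᵇ T U) (subsetsOf E)))

-- ξ([S , E]) = Σ_c (-1)^{|c|-1} over chains c from S to E.
-- A chain has pairwise distinct elements among the subsets of E, so
-- k ranges over 0 … (number of subsets of E) which covers all chains.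
ξ : {n : ℕ} → Edges n → Edges n → ℤ
ξ E S = sumℤ (map (λ k → negOnePow k * + chainCount E k S)
                   (upTo (suc (length (subsetsOf E)))))

IsPartition : ℕ → List ℕ → Set
IsPartition n λs = All (0 <_) λs × Linked _≥_ λs × sumℕ λs ≡ n

blockOf : List ℕ → ℕ → ℕ
blockOf []       k = 0
blockOf (p ∷ ps) k = if k <ᵇ p then 0 else suc (blockOf ps (k ∸ p))

-- P_λ on vertices 0 … n-1 (n = |λ|): the paths occupy consecutive blocks
-- of sizes λ_1, λ_2, …, each directed i → i+1 inside its block.
sticks : (n : ℕ) → List ℕ → Edges n
sticks n λs = V.tabulate (λ i → V.tabulate (λ j →
  (toℕ j ≡ᵇ suc (toℕ i)) ∧ (blockOf λs (toℕ i) ≡ᵇ blockOf λs (toℕ j))))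

Iso : {n : ℕ} → Edges n → Edges n → Set
Iso {n} A B = ∃ λ (π : Vec (Fin n) n) →
  T (injectiveᵇ π) × (∀ i j → edge A i j ≡ edge B (lookup π i) (lookup π j))

-- If T is not a bag of sticks, then for every listing σ some
-- edge e of T is not of the form (σ_k, σ_{k+1}), and toggling e is an involution on the subsets U ⊆ T that
-- keeps σ (f, U)-friendly and flips (-1)^{|T|-|U|}. Hence Σ_{U ⊆ T} (-1)^{|T|-|U|} W_U = 0: W_T is minus the
-- alternating sum of W over the proper subsets of T. Substituting this repeatedly, starting at E, walks down
-- the chains of the edge poset until they reach a bag; the bags among the subsets of E are exactly its
-- minimal elements (the empty edge set lies below every non-bag), and the signed count of the chains from S
-- up to E is ξ([S, E]). Summing over the rearrangements of a word gives the statement for U, where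
-- W_{(V,S)} may be replaced by W_{P_λ(S)} because U is invariant under relabelling the vertices.

module Submission where

open import Defs
open import Data.Bool as Bool using (Bool; true; false; _∧_; _∨_; not; if_then_else_; T)
import Data.Bool.Properties as Boolₚ
open import Data.Bool.ListAction using (all; any)
open import Data.Nat as ℕ using (ℕ; zero; suc; _∸_; _≤_; _<_; z≤n; s≤s)
import Data.Nat.Properties as ℕₚ
open import Data.Fin as Fin using (Fin)
import Data.Fin.Properties as Finₚ
open import Data.List
  using (List; []; _∷_; _++_; _∷ʳ_; map; filterᵇ; concatMap; length; allFin; upTo; cartesianProductWith)
import Data.List.Properties as Listₚ
open import Data.List.Membership.Propositional using (_∈_)
open import Data.List.Membership.Propositional.Properties
  using (∈-map⁺; ∈-map⁻; ∈-++⁺ˡ; ∈-++⁺ʳ; ∈-++⁻; ∈-∃++; ∈-filter⁺; ∈-filter⁻; ∈-allFin;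
         ∈-cartesianProductWith⁺; ∈-deduplicate⁺; ∈-deduplicate⁻)
open import Data.List.Relation.Unary.Any using (here; there)
import Data.List.Relation.Unary.All as All
open import Data.List.Relation.Unary.AllPairs as AllPairs using (_∷_)
open import Data.List.Relation.Unary.Unique.Propositional using (Unique)
import Data.List.Relation.Unary.Unique.Propositional.Properties as Uniqueₚ
open import Data.List.Relation.Unary.Unique.DecPropositional.Properties using (deduplicate-!)
open import Data.Vec as Vec using (Vec; lookup; toList)
import Data.Vec.Properties as Vecₚ
open import Data.Integer using (ℤ; +_; -_; _+_; _*_)
import Data.Integer.Properties as ℤₚ
open import Data.Integer.Tactic.RingSolver using (solve-∀)
open import Data.Product using (_×_; _,_; proj₁; proj₂; ∃)
import Data.Product.Properties as Productₚ
open import Data.Sum using (inj₁; inj₂)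
open import Function using (_∘_; id)
open import Function.Definitions using (Injective)
open import Relation.Nullary using (yes; no; contradiction)
open import Relation.Nullary.Decidable using (⌊_⌋; T?)
open import Relation.Binary.Definitions using (DecidableEquality)
open import Relation.Binary.PropositionalEquality
  using (_≡_; _≢_; refl; sym; trans; cong; cong₂; subst; module ≡-Reasoning)
open ≡-Reasoning

private
  variable
    A B C : Set
    n : ℕ

-- Finite sums over lists

∑ : List A → (A → ℤ) → ℤ
∑ xs g = sumℤ (map g xs)

infix 5 ∑
syntax ∑ xs (λ x → g) = ∑[ x ∈ xs ] g

when : Bool → ℤ → ℤ
when b z = if b then z else + 0

𝟙 : Bool → ℤ
𝟙 b = when b (+ 1)

∑-cong : ∀ (xs : List A) {g h : A → ℤ} → (∀ {x} → x ∈ xs → g x ≡ h x) → ∑ xs g ≡ ∑ xs h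
∑-cong []       eq = refl
∑-cong (x ∷ xs) eq = cong₂ _+_ (eq (here refl)) (∑-cong xs (eq ∘ there))

∑-cong′ : ∀ (xs : List A) {g h : A → ℤ} → (∀ x → g x ≡ h x) → ∑ xs g ≡ ∑ xs h
∑-cong′ xs eq = ∑-cong xs (λ {x} _ → eq x)

∑-zero : ∀ (xs : List A) {g : A → ℤ} → (∀ {x} → x ∈ xs → g x ≡ + 0) → ∑ xs g ≡ + 0
∑-zero []       eq = refl
∑-zero (x ∷ xs) eq = cong₂ _+_ (eq (here refl)) (∑-zero xs (eq ∘ there))

∑-++ : ∀ (xs ys : List A) (g : A → ℤ) → ∑ (xs ++ ys) g ≡ ∑ xs g + ∑ ys g
∑-++ []       ys g = sym (ℤₚ.+-identityˡ _)
∑-++ (x ∷ xs) ys g = trans (cong (_+_ (g x)) (∑-++ xs ys g)) (sym (ℤₚ.+-assoc (g x) _ _))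

∑-distrib-+ : ∀ (xs : List A) (g h : A → ℤ) → ∑[ x ∈ xs ] (g x + h x) ≡ ∑ xs g + ∑ xs h
∑-distrib-+ []       g h = refl
∑-distrib-+ (x ∷ xs) g h =
  trans (cong (_+_ (g x + h x)) (∑-distrib-+ xs g h)) (interchange (g x) (h x) (∑ xs g) (∑ xs h))
  where
  interchange : ∀ a b c d → (a + b) + (c + d) ≡ (a + c) + (b + d)
  interchange = solve-∀

∑-distribˡ-* : ∀ (c : ℤ) (xs : List A) (g : A → ℤ) → ∑[ x ∈ xs ] (c * g x) ≡ c * ∑ xs g
∑-distribˡ-* c []       g = sym (ℤₚ.*-zeroʳ c)
∑-distribˡ-* c (x ∷ xs) g =
  trans (cong (_+_ (c * g x)) (∑-distribˡ-* c xs g)) (sym (ℤₚ.*-distribˡ-+ c (g x) (∑ xs g)))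

∑-distribʳ-* : ∀ (c : ℤ) (xs : List A) (g : A → ℤ) → ∑[ x ∈ xs ] (g x * c) ≡ ∑ xs g * c
∑-distribʳ-* c xs g = begin
  ∑[ x ∈ xs ] (g x * c) ≡⟨ ∑-cong′ xs (λ x → ℤₚ.*-comm (g x) c) ⟩
  ∑[ x ∈ xs ] (c * g x) ≡⟨ ∑-distribˡ-* c xs g ⟩
  c * ∑ xs g            ≡⟨ ℤₚ.*-comm c _ ⟩
  ∑ xs g * c            ∎

∑-neg : ∀ (xs : List A) (g : A → ℤ) → ∑[ x ∈ xs ] (- g x) ≡ - ∑ xs g
∑-neg []       g = refl
∑-neg (x ∷ xs) g = trans (cong (_+_ (- g x)) (∑-neg xs g)) (sym (ℤₚ.neg-distrib-+ (g x) (∑ xs g)))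

∑-comm : ∀ (xs : List A) (ys : List B) (h : A → B → ℤ) →
         ∑[ x ∈ xs ] ∑[ y ∈ ys ] h x y ≡ ∑[ y ∈ ys ] ∑[ x ∈ xs ] h x y
∑-comm []       ys h = sym (∑-zero ys (λ _ → refl))
∑-comm (x ∷ xs) ys h =
  trans (cong (_+_ (∑ ys (h x))) (∑-comm xs ys h)) (sym (∑-distrib-+ ys (h x) _))

∑-when : ∀ (b : Bool) (xs : List A) (g : A → ℤ) → ∑[ x ∈ xs ] when b (g x) ≡ when b (∑ xs g)
∑-when true  xs g = refl
∑-when false xs g = ∑-zero xs (λ _ → refl)

∑-filterᵇ : ∀ (p : A → Bool) (xs : List A) (g : A → ℤ) →
            ∑ (filterᵇ p xs) g ≡ ∑[ x ∈ xs ] when (p x) (g x)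
∑-filterᵇ p []       g = refl
∑-filterᵇ p (x ∷ xs) g with p x
... | true  = cong (_+_ (g x)) (∑-filterᵇ p xs g)
... | false = trans (∑-filterᵇ p xs g) (sym (ℤₚ.+-identityˡ _))

length-filterᵇ : ∀ (p : A → Bool) (xs : List A) → + length (filterᵇ p xs) ≡ ∑[ x ∈ xs ] 𝟙 (p x)
length-filterᵇ p []       = refl
length-filterᵇ p (x ∷ xs) with p x
... | true  = trans (ℤₚ.pos-+ 1 _) (cong (_+_ (+ 1)) (length-filterᵇ p xs))
... | false = trans (length-filterᵇ p xs) (sym (ℤₚ.+-identityˡ _))

sumℕ-∑ : ∀ (f : A → ℕ) (xs : List A) → + sumℕ (map f xs) ≡ ∑[ x ∈ xs ] + f x
sumℕ-∑ f []       = refl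
sumℕ-∑ f (x ∷ xs) = trans (ℤₚ.pos-+ (f x) _) (cong (_+_ (+ f x)) (sumℕ-∑ f xs))

when-+0 : ∀ b → when b (+ 0) ≡ + 0
when-+0 true  = refl
when-+0 false = refl

split-when-not : ∀ (b : Bool) (x : ℤ) → x ≡ when b x + when (not b) x
split-when-not true  x = sym (ℤₚ.+-identityʳ x)
split-when-not false x = sym (ℤₚ.+-identityˡ x)

split-when-≡ : ∀ (s e : Bool) (x : ℤ) → (e ≡ true → s ≡ true) →
               when s x ≡ when (s ∧ not e) x + when e x
split-when-≡ true  true  x _ = sym (ℤₚ.+-identityˡ x)
split-when-≡ true  false x _ = sym (ℤₚ.+-identityʳ x)
split-when-≡ false false x _ = refl
split-when-≡ false true  x e⇒s = contradiction (e⇒s refl) λ ()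

sum≡0⇒≡neg : ∀ a b → a + b ≡ + 0 → b ≡ - a
sum≡0⇒≡neg a b a+b≡0 = begin
  b             ≡⟨ rearrange a b ⟩
  - a + (a + b) ≡⟨ cong (_+_ (- a)) a+b≡0 ⟩
  - a + + 0     ≡⟨ ℤₚ.+-identityʳ (- a) ⟩
  - a           ∎
  where
  rearrange : ∀ a b → b ≡ - a + (a + b)
  rearrange = solve-∀

∑-δ : ∀ (_≟_ : DecidableEquality A) {xs : List A} → Unique xs →
      ∀ (h : A → ℤ) {t} → t ∈ xs → ∑[ x ∈ xs ] when ⌊ x ≟ t ⌋ (h x) ≡ h t
∑-δ _≟_ {x ∷ xs} (x∉xs ∷ xs!) h {t} t∈ with x ≟ t | t∈
... | yes refl | _ = trans (cong (_+_ (h x)) (∑-zero xs absent)) (ℤₚ.+-identityʳ (h x))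
  where
  absent : ∀ {y} → y ∈ xs → when ⌊ y ≟ x ⌋ (h y) ≡ + 0
  absent {y} y∈ with y ≟ x
  ... | yes refl = contradiction refl (All.lookup x∉xs y∈)
  ... | no _     = refl
... | no x≢t | here x≡t = contradiction (sym x≡t) x≢t
... | no _   | there t∈xs = trans (ℤₚ.+-identityˡ _) (∑-δ _≟_ xs! h t∈xs)

∑-reindex : ∀ (_≟_ : DecidableEquality A) {xs : List A} → Unique xs →
            ∀ (φ ψ : A → A) →
            (∀ {x} → x ∈ xs → φ x ∈ xs) → (∀ {x} → x ∈ xs → ψ x ∈ xs) →
            (∀ {x} → x ∈ xs → ψ (φ x) ≡ x) → (∀ {x} → x ∈ xs → φ (ψ x) ≡ x) →
            ∀ (h : A → ℤ) → ∑[ x ∈ xs ] h (φ x) ≡ ∑ xs h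
∑-reindex _≟_ {xs} xs! φ ψ φ∈ ψ∈ ψφ φψ h = begin
  ∑[ x ∈ xs ] h (φ x)
    ≡⟨ ∑-cong xs (λ x∈ → sym (∑-δ _≟_ xs! h (φ∈ x∈))) ⟩
  ∑[ x ∈ xs ] ∑[ y ∈ xs ] when ⌊ y ≟ φ x ⌋ (h y)
    ≡⟨ ∑-comm xs xs _ ⟩
  ∑[ y ∈ xs ] ∑[ x ∈ xs ] when ⌊ y ≟ φ x ⌋ (h y)
    ≡⟨ ∑-cong xs (λ y∈ → ∑-cong xs (λ x∈ → cong (λ b → when b _) (swap y∈ x∈))) ⟩
  ∑[ y ∈ xs ] ∑[ x ∈ xs ] when ⌊ x ≟ ψ y ⌋ (h y)
    ≡⟨ ∑-cong xs (λ y∈ → ∑-δ _≟_ xs! (λ _ → h _) (ψ∈ y∈)) ⟩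
  ∑ xs h                                             ∎
  where
  swap : ∀ {y x} → y ∈ xs → x ∈ xs → ⌊ y ≟ φ x ⌋ ≡ ⌊ x ≟ ψ y ⌋
  swap {y} {x} y∈ x∈ with y ≟ φ x | x ≟ ψ y
  ... | yes _    | yes _    = refl
  ... | no _     | no _     = refl
  ... | yes refl | no x≢ψy  = contradiction (sym (ψφ x∈)) x≢ψy
  ... | no y≢φx  | yes refl = contradiction (sym (φψ y∈)) y≢φx

∑-sign-reversing-involution :
  ∀ (_≟_ : DecidableEquality A) {xs : List A} → Unique xs →
  ∀ (ι : A → A) → (∀ {x} → x ∈ xs → ι x ∈ xs) → (∀ {x} → x ∈ xs → ι (ι x) ≡ x) →
  ∀ (g : A → ℤ) → (∀ {x} → x ∈ xs → g (ι x) ≡ - g x) → ∑ xs g ≡ + 0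
∑-sign-reversing-involution _≟_ {xs} xs! ι ι∈ ιι g reverses = self-negating (begin
  ∑ xs g                  ≡⟨ ∑-reindex _≟_ xs! ι ι ι∈ ι∈ ιι ιι g ⟨
  ∑[ x ∈ xs ] g (ι x)     ≡⟨ ∑-cong xs reverses ⟩
  ∑[ x ∈ xs ] (- g x)     ≡⟨ ∑-neg xs g ⟩
  - ∑ xs g                ∎)
  where
  self-negating : ∀ {z} → z ≡ - z → z ≡ + 0
  self-negating {+ zero} _ = refl

telescope : ∀ (F D : ℕ → ℤ) → (∀ k → F k ≡ D k + F (suc k)) → ∀ m → F 0 ≡ ∑ (upTo m) D + F m
telescope F D step zero    = sym (ℤₚ.+-identityˡ (F 0))
telescope F D step (suc m) = begin
  F 0                                   ≡⟨ telescope F D step m ⟩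
  ∑ (upTo m) D + F m                    ≡⟨ cong (_+_ (∑ (upTo m) D)) (step m) ⟩
  ∑ (upTo m) D + (D m + F (suc m))      ≡⟨ ℤₚ.+-assoc (∑ (upTo m) D) (D m) (F (suc m)) ⟨
  ∑ (upTo m) D + D m + F (suc m)        ≡⟨ cong (_+ F (suc m)) last ⟩
  ∑ (upTo (suc m)) D + F (suc m)        ∎
  where
  last : ∑ (upTo m) D + D m ≡ ∑ (upTo (suc m)) D
  last = begin
    ∑ (upTo m) D + D m             ≡⟨ cong (_+_ (∑ (upTo m) D)) (ℤₚ.+-identityʳ (D m)) ⟨
    ∑ (upTo m) D + ∑ (m ∷ []) D    ≡⟨ ∑-++ (upTo m) (m ∷ []) D ⟨
    ∑ (upTo m ∷ʳ m) D              ≡⟨ cong (λ ks → ∑ ks D) (Listₚ.upTo-∷ʳ m) ⟩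
    ∑ (upTo (suc m)) D             ∎

T⇒≡true : ∀ {b} → T b → b ≡ true
T⇒≡true {true} _ = refl

≡true⇒T : ∀ {b} → b ≡ true → T b
≡true⇒T refl = _

Bool-ext : ∀ {a b} → (a ≡ true → b ≡ true) → (b ≡ true → a ≡ true) → a ≡ b
Bool-ext {true}  a⇒b _   = sym (a⇒b refl)
Bool-ext {false} {true}  _ b⇒a = b⇒a refl
Bool-ext {false} {false} _ _   = refl

∈-filterᵇ⁺ : ∀ (p : A → Bool) {x xs} → x ∈ xs → p x ≡ true → x ∈ filterᵇ p xs
∈-filterᵇ⁺ p x∈ px = ∈-filter⁺ (T? ∘ p) x∈ (≡true⇒T px)

∈-filterᵇ⁻ : ∀ (p : A → Bool) {x} xs → x ∈ filterᵇ p xs → x ∈ xs × p x ≡ true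
∈-filterᵇ⁻ p xs x∈ with x∈xs , px ← ∈-filter⁻ (T? ∘ p) {xs = xs} x∈ = x∈xs , T⇒≡true px

filterᵇ-unique : ∀ (p : A → Bool) {xs} → Unique xs → Unique (filterᵇ p xs)
filterᵇ-unique p = Uniqueₚ.filter⁺ (T? ∘ p)

all-true⁻ : ∀ (p : A → Bool) xs → all p xs ≡ true → ∀ {x} → x ∈ xs → p x ≡ true
all-true⁻ p (y ∷ xs) eq (here refl) with p y | eq
... | true | _ = refl
all-true⁻ p (y ∷ xs) eq (there x∈) with p y | eq
... | true | eq′ = all-true⁻ p xs eq′ x∈

all-true⁺ : ∀ (p : A → Bool) xs → (∀ {x} → x ∈ xs → p x ≡ true) → all p xs ≡ true
all-true⁺ p []       _   = refl
all-true⁺ p (y ∷ xs) hyp rewrite hyp (here refl) = all-true⁺ p xs (hyp ∘ there)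

all-false⁻ : ∀ (p : A → Bool) xs → all p xs ≡ false → ∃ λ x → x ∈ xs × p x ≡ false
all-false⁻ p (y ∷ xs) eq with p y in py
... | false = y , here refl , py
... | true with x , x∈ , px ← all-false⁻ p xs eq = x , there x∈ , px

all-false⁺ : ∀ (p : A → Bool) {x} xs → x ∈ xs → p x ≡ false → all p xs ≡ false
all-false⁺ p (y ∷ xs) (here refl) px rewrite px = refl
all-false⁺ p (y ∷ xs) (there x∈) px rewrite all-false⁺ p xs x∈ px = Boolₚ.∧-zeroʳ (p y)

all-cong : ∀ (p q : A → Bool) xs → (∀ {x} → x ∈ xs → p x ≡ q x) → all p xs ≡ all q xs
all-cong p q []       _  = refl
all-cong p q (y ∷ xs) eq = cong₂ _∧_ (eq (here refl)) (all-cong p q xs (eq ∘ there))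

any-true⁺ : ∀ (p : A → Bool) {x} xs → x ∈ xs → p x ≡ true → any p xs ≡ true
any-true⁺ p (y ∷ xs) (here refl) px rewrite px = refl
any-true⁺ p (y ∷ xs) (there x∈) px rewrite any-true⁺ p xs x∈ px = Boolₚ.∨-zeroʳ (p y)

any-false⁻ : ∀ (p : A → Bool) xs → any p xs ≡ false → ∀ {x} → x ∈ xs → p x ≡ false
any-false⁻ p (y ∷ xs) eq (here refl) with p y | eq
... | false | _ = refl
any-false⁻ p (y ∷ xs) eq (there x∈) with p y | eq
... | false | eq′ = any-false⁻ p xs eq′ x∈

length-filterᵇ-mono : ∀ (p q : A → Bool) xs → (∀ {x} → x ∈ xs → p x ≡ true → q x ≡ true) →
                      length (filterᵇ p xs) ≤ length (filterᵇ q xs)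
length-filterᵇ-mono p q []       _   = z≤n
length-filterᵇ-mono p q (x ∷ xs) p⇒q with p x in px | q x in qx
... | true  | true  = s≤s (length-filterᵇ-mono p q xs (p⇒q ∘ there))
... | true  | false = contradiction (trans (sym (p⇒q (here refl) px)) qx) λ ()
... | false | true  = ℕₚ.m≤n⇒m≤1+n (length-filterᵇ-mono p q xs (p⇒q ∘ there))
... | false | false = length-filterᵇ-mono p q xs (p⇒q ∘ there)

Unique-⊆⇒length-≤ : ∀ {xs ys : List A} → Unique xs → (∀ {x} → x ∈ xs → x ∈ ys) → length xs ≤ length ys
Unique-⊆⇒length-≤ {xs = []}     _            _  = z≤n
Unique-⊆⇒length-≤ {xs = x ∷ xs} (x∉xs ∷ xs!) xs⊆ys
  with ys₁ , ys₂ , refl ← ∈-∃++ (xs⊆ys (here refl)) =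
  subst (suc (length xs) ≤_) (sym (trans (Listₚ.length-++ ys₁) (ℕₚ.+-suc (length ys₁) (length ys₂))))
    (s≤s (subst (length xs ≤_) (Listₚ.length-++ ys₁) (Unique-⊆⇒length-≤ xs! xs⊆ys₁ys₂)))
  where
  xs⊆ys₁ys₂ : ∀ {z} → z ∈ xs → z ∈ ys₁ ++ ys₂
  xs⊆ys₁ys₂ z∈ with ∈-++⁻ ys₁ (xs⊆ys (there z∈))
  ... | inj₁ z∈ys₁         = ∈-++⁺ˡ z∈ys₁
  ... | inj₂ (here refl)   = contradiction refl (All.lookup x∉xs z∈)
  ... | inj₂ (there z∈ys₂) = ∈-++⁺ʳ ys₁ z∈ys₂

concatMap≡cartesianProductWith : ∀ (f : A → B → C) xs ys →
  concatMap (λ x → map (f x) ys) xs ≡ cartesianProductWith f xs ys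
concatMap≡cartesianProductWith f []       ys = refl
concatMap≡cartesianProductWith f (x ∷ xs) ys =
  cong (map (f x) ys ++_) (concatMap≡cartesianProductWith f xs ys)

consecPairs-map : ∀ (h : A → B) xs →
                  consecPairs (map h xs) ≡ map (λ (x , y) → h x , h y) (consecPairs xs)
consecPairs-map h []           = refl
consecPairs-map h (x ∷ [])     = refl
consecPairs-map h (x ∷ y ∷ xs) = cong ((h x , h y) ∷_) (consecPairs-map h (y ∷ xs))

lookup-ext : ∀ {m} (u v : Vec A m) → (∀ i → lookup u i ≡ lookup v i) → u ≡ v
lookup-ext u v eq =
  trans (sym (Vecₚ.tabulate∘lookup u)) (trans (Vecₚ.tabulate-cong eq) (Vecₚ.tabulate∘lookup v))

injective⇒surjective : ∀ {q : Fin n → Fin n} → Injective _≡_ _≡_ q → ∀ y → ∃ λ x → q x ≡ y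
injective⇒surjective {suc m} {q} q-injective y with Finₚ.any? (λ x → q x Fin.≟ y)
... | yes found = found
... | no missed = contradiction (Finₚ.injective⇒≤ punched-injective) ℕₚ.1+n≰n
  where
  -- A value y that q misses lets q factor injectively through Fin m.
  punched : Fin (suc m) → Fin m
  punched x = Fin.punchOut {i = y} {j = q x} (λ y≡qx → missed (x , sym y≡qx))
  punched-injective : ∀ {x x′} → punched x ≡ punched x′ → x ≡ x′
  punched-injective {x} {x′} eq =
    q-injective (Finₚ.punchOut-injective (λ e → missed (x , sym e)) (λ e → missed (x′ , sym e)) eq)

permute : (Fin n → Fin n) → Vec A n → Vec A n
permute q w = Vec.tabulate (lookup w ∘ q)

lookup-permute : ∀ (q : Fin n → Fin n) (w : Vec A n) i → lookup (permute q w) i ≡ lookup w (q i)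
lookup-permute q w = Vecₚ.lookup∘tabulate (lookup w ∘ q)

map-inverse : ∀ (q r : A → A) → (∀ x → r (q x) ≡ x) →
              ∀ {m} (v : Vec A m) → Vec.map r (Vec.map q v) ≡ v
map-inverse q r rq v = lookup-ext _ v λ i →
  trans (Vecₚ.lookup-map i r (Vec.map q v)) (trans (cong r (Vecₚ.lookup-map i q v)) (rq (lookup v i)))

permute-inverse : ∀ (q r : Fin n → Fin n) → (∀ x → q (r x) ≡ x) →
                  ∀ (w : Vec A n) → permute r (permute q w) ≡ w
permute-inverse q r qr w = lookup-ext _ w λ i →
  trans (lookup-permute r (permute q w) i) (trans (lookup-permute q w (r i)) (cong (lookup w) (qr i)))

-- Edge sets and listings

vecsOver-unique : ∀ {xs : List A} m → Unique xs → Unique (vecsOver xs m)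
vecsOver-unique zero    xs! = All.[] ∷ AllPairs.[]
vecsOver-unique {xs = xs} (suc m) xs! =
  subst Unique (sym (concatMap≡cartesianProductWith Vec._∷_ xs (vecsOver xs m)))
    (Uniqueₚ.cartesianProductWith⁺ Vec._∷_ Vecₚ.∷-injective xs! (vecsOver-unique m xs!))

∈-vecsOver : ∀ {xs : List A} → (∀ x → x ∈ xs) → ∀ {m} (v : Vec A m) → v ∈ vecsOver xs m
∈-vecsOver          all∈ Vec.[]       = here refl
∈-vecsOver {xs = xs} all∈ {suc m} (x Vec.∷ v) =
  subst (_ ∈_) (sym (concatMap≡cartesianProductWith Vec._∷_ xs (vecsOver xs m)))
    (∈-cartesianProductWith⁺ Vec._∷_ (all∈ x) (∈-vecsOver all∈ v))

pairs-unique : ∀ n → Unique (pairs n)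
pairs-unique n = subst Unique (sym (concatMap≡cartesianProductWith _,_ (allFin n) (allFin n)))
  (Uniqueₚ.cartesianProduct⁺ (Uniqueₚ.allFin⁺ n) (Uniqueₚ.allFin⁺ n))

∈-pairs : ∀ (i j : Fin n) → (i , j) ∈ pairs n
∈-pairs {n} i j = subst (_ ∈_) (sym (concatMap≡cartesianProductWith _,_ (allFin n) (allFin n)))
  (∈-cartesianProductWith⁺ _,_ (∈-allFin i) (∈-allFin j))

∈-Bool : ∀ b → b ∈ true ∷ false ∷ []
∈-Bool true  = here refl
∈-Bool false = there (here refl)

allEdgeSets-unique : ∀ n → Unique (allEdgeSets n)
allEdgeSets-unique n = vecsOver-unique n (vecsOver-unique n (((λ ()) All.∷ All.[]) ∷ All.[] ∷ AllPairs.[]))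

∈-allEdgeSets : ∀ (U : Edges n) → U ∈ allEdgeSets n
∈-allEdgeSets = ∈-vecsOver (∈-vecsOver ∈-Bool)

injectiveᵇ⁺ : ∀ (σ : Vec (Fin n) n) → Injective _≡_ _≡_ (lookup σ) → injectiveᵇ σ ≡ true
injectiveᵇ⁺ {n} σ σ-injective = all-true⁺ _ (pairs n) λ { {i , j} _ → separates i j }
  where
  separates : ∀ i j → ⌊ i Fin.≟ j ⌋ ∨ not ⌊ lookup σ i Fin.≟ lookup σ j ⌋ ≡ true
  separates i j with i Fin.≟ j | lookup σ i Fin.≟ lookup σ j
  ... | yes _  | _       = refl
  ... | no _   | no _    = refl
  ... | no i≢j | yes σij = contradiction (σ-injective σij) i≢j

injectiveᵇ⁻ : ∀ (σ : Vec (Fin n) n) → injectiveᵇ σ ≡ true → Injective _≡_ _≡_ (lookup σ)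
injectiveᵇ⁻ {n} σ injᵇ {i} {j} σij
  with i Fin.≟ j | lookup σ i Fin.≟ lookup σ j | all-true⁻ _ (pairs n) injᵇ (∈-pairs i j)
... | yes i≡j | _        | _  = i≡j
... | no _    | yes _    | ()
... | no _    | no σi≢σj | _  = contradiction σij σi≢σj

listings-unique : ∀ n → Unique (listings n)
listings-unique n = filterᵇ-unique injectiveᵇ (vecsOver-unique n (Uniqueₚ.allFin⁺ n))

∈-listings : ∀ (σ : Vec (Fin n) n) → injectiveᵇ σ ≡ true → σ ∈ listings n
∈-listings σ inj = ∈-filterᵇ⁺ injectiveᵇ (∈-vecsOver ∈-allFin σ) inj

∈-listings⁻ : ∀ {σ : Vec (Fin n) n} → σ ∈ listings n → injectiveᵇ σ ≡ true
∈-listings⁻ {n} σ∈ = proj₂ (∈-filterᵇ⁻ injectiveᵇ (vecsOver (allFin n) n) σ∈)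

∈-listings-∘ : ∀ {σ τ : Vec (Fin n) n} (f g : Fin n → Fin n) → Injective _≡_ _≡_ f → Injective _≡_ _≡_ g →
               (∀ i → lookup τ i ≡ f (lookup σ (g i))) → σ ∈ listings n → τ ∈ listings n
∈-listings-∘ {σ = σ} {τ} f g f-inj g-inj τ≗fσg σ∈ = ∈-listings τ (injectiveᵇ⁺ τ λ {i} {j} τij →
  g-inj (injectiveᵇ⁻ σ (∈-listings⁻ σ∈) (f-inj (trans (sym (τ≗fσg i)) (trans τij (τ≗fσg j))))))

∈-rearrangements-permute : ∀ (a : Vec ℕ n) q → Injective _≡_ _≡_ q →
                           ∀ {w} → w ∈ rearrangements a → permute q w ∈ rearrangements a
∈-rearrangements-permute {n} a q q-injective w∈
  with σ , σ∈ , refl ← ∈-map⁻ (Vec.map (lookup a)) (∈-deduplicate⁻ (Vecₚ.≡-dec ℕ._≟_) _ w∈) =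
  ∈-deduplicate⁺ (Vecₚ.≡-dec ℕ._≟_)
    (subst (_∈ map (Vec.map (lookup a)) (listings n)) same-word
      (∈-map⁺ (Vec.map (lookup a)) (∈-listings-∘ id q id q-injective (lookup-permute q σ) σ∈)))
  where
  same-word : Vec.map (lookup a) (permute q σ) ≡ permute q (Vec.map (lookup a) σ)
  same-word = lookup-ext _ _ λ i → begin
    lookup (Vec.map (lookup a) (permute q σ)) i   ≡⟨ Vecₚ.lookup-map i (lookup a) (permute q σ) ⟩
    lookup a (lookup (permute q σ) i)             ≡⟨ cong (lookup a) (lookup-permute q σ i) ⟩
    lookup a (lookup σ (q i))                     ≡⟨ Vecₚ.lookup-map (q i) (lookup a) σ ⟨
    lookup (Vec.map (lookup a) σ) (q i)           ≡⟨ lookup-permute q (Vec.map (lookup a) σ) i ⟨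
    lookup (permute q (Vec.map (lookup a) σ)) i   ∎

_≟ᴱ_ : DecidableEquality (Edges n)
_≟ᴱ_ = Vecₚ.≡-dec (Vecₚ.≡-dec Bool._≟_)

_≟ᴾ_ : DecidableEquality (Fin n × Fin n)
_≟ᴾ_ = Productₚ.≡-dec Fin._≟_ Fin._≟_

edges-ext : ∀ (U V : Edges n) → (∀ i j → edge U i j ≡ edge V i j) → U ≡ V
edges-ext U V eq = lookup-ext U V (λ i → lookup-ext (lookup U i) (lookup V i) (eq i))

infix 4 _⊆ᴱ_

_⊆ᴱ_ : Edges n → Edges n → Set
U ⊆ᴱ V = ∀ {i j} → edge U i j ≡ true → edge V i j ≡ true

subsetᵇ⁻ : ∀ (U V : Edges n) → subsetᵇ U V ≡ true → U ⊆ᴱ V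
subsetᵇ⁻ {n} U V eq {i} {j} e = implies (edge U i j) (all-true⁻ _ (pairs n) eq (∈-pairs i j)) e
  where
  implies : ∀ a {b} → not a ∨ b ≡ true → a ≡ true → b ≡ true
  implies true eq refl = eq

subsetᵇ⁺ : ∀ (U V : Edges n) → U ⊆ᴱ V → subsetᵇ U V ≡ true
subsetᵇ⁺ {n} U V U⊆V = all-true⁺ _ (pairs n) (λ { {i , j} _ → implied (edge U i j) U⊆V })
  where
  implied : ∀ a {b} → (a ≡ true → b ≡ true) → not a ∨ b ≡ true
  implied true  a⇒b = a⇒b refl
  implied false _   = refl

subsetᵇ-refl : ∀ (U : Edges n) → subsetᵇ U U ≡ true
subsetᵇ-refl U = subsetᵇ⁺ U U id

subsetᵇ-trans : ∀ (U V W : Edges n) → subsetᵇ U V ≡ true → subsetᵇ V W ≡ true → subsetᵇ U W ≡ true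
subsetᵇ-trans U V W U⊆V V⊆W = subsetᵇ⁺ U W (subsetᵇ⁻ V W V⊆W ∘ subsetᵇ⁻ U V U⊆V)

∈-subsetsOf : ∀ {U} (E : Edges n) → subsetᵇ U E ≡ true → U ∈ subsetsOf E
∈-subsetsOf {U = U} E U⊆E = ∈-filterᵇ⁺ _ (∈-allEdgeSets U) U⊆E

∈-subsetsOf⁻ : ∀ {U} (E : Edges n) → U ∈ subsetsOf E → subsetᵇ U E ≡ true
∈-subsetsOf⁻ {n} E U∈ = proj₂ (∈-filterᵇ⁻ _ (allEdgeSets n) U∈)

subsetsOf-unique : ∀ (E : Edges n) → Unique (subsetsOf E)
subsetsOf-unique {n} E = filterᵇ-unique _ (allEdgeSets-unique n)

∑-subsetsOf-⊆ : ∀ (T E : Edges n) → subsetᵇ T E ≡ true → ∀ (g : Edges n → ℤ) →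
                ∑ (subsetsOf T) g ≡ ∑[ U ∈ subsetsOf E ] when (subsetᵇ U T) (g U)
∑-subsetsOf-⊆ {n} T E T⊆E g = begin
  ∑ (subsetsOf T) g
    ≡⟨ ∑-filterᵇ _ (allEdgeSets n) g ⟩
  ∑[ U ∈ allEdgeSets n ] when (subsetᵇ U T) (g U)
    ≡⟨ ∑-cong′ (allEdgeSets n) restrict ⟩
  ∑[ U ∈ allEdgeSets n ] when (subsetᵇ U E) (when (subsetᵇ U T) (g U))
    ≡⟨ ∑-filterᵇ _ (allEdgeSets n) _ ⟨
  ∑[ U ∈ subsetsOf E ] when (subsetᵇ U T) (g U)                          ∎
  where
  restrict : ∀ U → when (subsetᵇ U T) (g U) ≡ when (subsetᵇ U E) (when (subsetᵇ U T) (g U))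
  restrict U with subsetᵇ U T in U⊆T
  ... | false = sym (when-+0 (subsetᵇ U E))
  ... | true rewrite subsetᵇ-trans U T E U⊆T T⊆E = refl

card-mono : ∀ (U V : Edges n) → U ⊆ᴱ V → card U ≤ card V
card-mono {n} U V U⊆V = length-filterᵇ-mono _ _ (pairs n) (λ { {i , j} _ → U⊆V })

card-∑ : ∀ (U : Edges n) → + card U ≡ ∑[ p ∈ pairs n ] 𝟙 (edge U (proj₁ p) (proj₂ p))
card-∑ {n} U = trans (length-filterᵇ _ (pairs n)) (∑-cong′ (pairs n) λ { (i , j) → refl })

toggle : Edges n → Fin n → Fin n → Edges n
toggle U i j = Vec.updateAt U i (λ row → Vec.updateAt row j not)

edge-toggle-≡ : ∀ (U : Edges n) i j → edge (toggle U i j) i j ≡ not (edge U i j)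
edge-toggle-≡ U i j =
  trans (cong (λ row → lookup row j) (Vecₚ.lookup∘updateAt i U)) (Vecₚ.lookup∘updateAt j (lookup U i))

edge-toggle-≢ : ∀ (U : Edges n) {i j k l} → (k , l) ≢ (i , j) → edge (toggle U i j) k l ≡ edge U k l
edge-toggle-≢ U {i} {j} {k} {l} kl≢ij with k Fin.≟ i
... | yes refl = trans (cong (λ row → lookup row l) (Vecₚ.lookup∘updateAt k U))
                       (Vecₚ.lookup∘updateAt′ l j (kl≢ij ∘ cong (k ,_)) (lookup U k))
... | no k≢i   = cong (λ row → lookup row l) (Vecₚ.lookup∘updateAt′ k i k≢i U)

toggle-involutive : ∀ (U : Edges n) i j → toggle (toggle U i j) i j ≡ U
toggle-involutive U i j = edges-ext _ U pointwise
  where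
  pointwise : ∀ k l → edge (toggle (toggle U i j) i j) k l ≡ edge U k l
  pointwise k l with (k , l) ≟ᴾ (i , j)
  ... | yes refl = trans (edge-toggle-≡ (toggle U i j) i j)
                         (trans (cong not (edge-toggle-≡ U i j)) (Boolₚ.not-involutive _))
  ... | no kl≢ij = trans (edge-toggle-≢ (toggle U i j) kl≢ij) (edge-toggle-≢ U kl≢ij)

card-toggle : ∀ (U : Edges n) {i j} → edge U i j ≡ false → card (toggle U i j) ≡ suc (card U)
card-toggle {n} U {i} {j} absent = ℤₚ.+-injective (begin
  + card (toggle U i j)
    ≡⟨ card-∑ (toggle U i j) ⟩
  ∑[ p ∈ pairs n ] 𝟙 (edge (toggle U i j) (proj₁ p) (proj₂ p))
    ≡⟨ ∑-cong′ (pairs n) pointwise ⟩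
  ∑[ p ∈ pairs n ] (𝟙 (edge U (proj₁ p) (proj₂ p)) + when ⌊ p ≟ᴾ (i , j) ⌋ (+ 1))
    ≡⟨ ∑-distrib-+ (pairs n) _ _ ⟩
  (∑[ p ∈ pairs n ] 𝟙 (edge U (proj₁ p) (proj₂ p)))
    + (∑[ p ∈ pairs n ] when ⌊ p ≟ᴾ (i , j) ⌋ (+ 1))
    ≡⟨ cong₂ _+_ (sym (card-∑ U)) (∑-δ _≟ᴾ_ (pairs-unique n) _ (∈-pairs i j)) ⟩
  + card U + + 1
    ≡⟨ ℤₚ.+-comm (+ card U) (+ 1) ⟩
  + suc (card U) ∎)
  where
  pointwise : ∀ p → 𝟙 (edge (toggle U i j) (proj₁ p) (proj₂ p))
                  ≡ 𝟙 (edge U (proj₁ p) (proj₂ p)) + when ⌊ p ≟ᴾ (i , j) ⌋ (+ 1)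
  pointwise (k , l) with (k , l) ≟ᴾ (i , j)
  ... | yes refl rewrite edge-toggle-≡ U i j | absent = refl
  ... | no kl≢ij = trans (cong 𝟙 (edge-toggle-≢ U kl≢ij)) (sym (ℤₚ.+-identityʳ _))

toggle-⊆ᴱ : ∀ (U T : Edges n) {i j} → edge T i j ≡ true → U ⊆ᴱ T → toggle U i j ⊆ᴱ T
toggle-⊆ᴱ U T {i} {j} inT U⊆T {k} {l} e with (k , l) ≟ᴾ (i , j)
... | yes refl = inT
... | no kl≢ij = U⊆T (trans (sym (edge-toggle-≢ U kl≢ij)) e)

subsetᵇ-toggle : ∀ (U T : Edges n) {i j} → edge T i j ≡ true →
                 subsetᵇ (toggle U i j) T ≡ subsetᵇ U T
subsetᵇ-toggle U T {i} {j} inT = Bool-ext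
  (λ U′⊆T → subsetᵇ⁺ U T (subst (_⊆ᴱ T) (toggle-involutive U i j)
                            (toggle-⊆ᴱ (toggle U i j) T inT (subsetᵇ⁻ (toggle U i j) T U′⊆T))))
  (λ U⊆T → subsetᵇ⁺ (toggle U i j) T (toggle-⊆ᴱ U T inT (subsetᵇ⁻ U T U⊆T)))

strictSubsetᵇ⇒subsetᵇ : ∀ (U V : Edges n) → strictSubsetᵇ U V ≡ true → subsetᵇ U V ≡ true
strictSubsetᵇ⇒subsetᵇ U V U⊊V with subsetᵇ U V | U⊊V
... | true | _ = refl

strictSubsetᵇ-irrefl : ∀ (U : Edges n) → strictSubsetᵇ U U ≡ false
strictSubsetᵇ-irrefl U with U ≟ᴱ U
... | yes _   = Boolₚ.∧-zeroʳ (subsetᵇ U U)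
... | no U≢U  = contradiction refl U≢U

strictSubset⇒missing-edge : ∀ (U V : Edges n) → strictSubsetᵇ U V ≡ true →
                            ∃ λ ((i , j) : Fin n × Fin n) → edge V i j ≡ true × edge U i j ≡ false
strictSubset⇒missing-edge {n} U V U⊊V with subsetᵇ V U in V⊆U
... | true = contradiction
  (trans (sym U⊊V) (subst (λ W → strictSubsetᵇ U W ≡ false) U≡V (strictSubsetᵇ-irrefl U))) λ ()
  where
  U≡V : U ≡ V
  U≡V = edges-ext U V λ i j → Bool-ext (subsetᵇ⁻ U V (strictSubsetᵇ⇒subsetᵇ U V U⊊V)) (subsetᵇ⁻ V U V⊆U)
... | false with (i , j) , _ , missing ← all-false⁻ _ (pairs n) V⊆U = (i , j) , split (edge V i j) missing
  where
  split : ∀ a {b} → not a ∨ b ≡ false → a ≡ true × b ≡ false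
  split true refl = refl , refl

card-strict : ∀ (U V : Edges n) → strictSubsetᵇ U V ≡ true → card U < card V
card-strict {n} U V U⊊V with (i , j) , inV , notInU ← strictSubset⇒missing-edge U V U⊊V =
  subst (suc (card U) ≤_) V′+1≡V (s≤s (card-mono U V′ U⊆V′))
  where
  V′ = toggle V i j
  V′-absent : edge V′ i j ≡ false
  V′-absent = trans (edge-toggle-≡ V i j) (cong not inV)
  V′+1≡V : suc (card V′) ≡ card V
  V′+1≡V = trans (sym (card-toggle V′ V′-absent)) (cong card (toggle-involutive V i j))
  U⊆V′ : U ⊆ᴱ V′
  U⊆V′ {k} {l} inU with (k , l) ≟ᴾ (i , j)
  ... | yes refl = contradiction (trans (sym inU) notInU) λ ()
  ... | no kl≢ij = trans (edge-toggle-≢ V kl≢ij) (subsetᵇ⁻ U V (strictSubsetᵇ⇒subsetᵇ U V U⊊V) inU)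

noEdges : ∀ n → Edges n
noEdges n = Vec.replicate n (Vec.replicate n false)

edge-noEdges : ∀ (i j : Fin n) → edge (noEdges n) i j ≡ false
edge-noEdges {n} i j =
  trans (cong (λ row → lookup row j) (Vecₚ.lookup-replicate i _)) (Vecₚ.lookup-replicate j false)

noEdges-⊆ᴱ : ∀ (U : Edges n) → noEdges n ⊆ᴱ U
noEdges-⊆ᴱ U {i} {j} e = contradiction (trans (sym e) (edge-noEdges i j)) λ ()

noEdges-isBag : ∀ n → isBagᵇ (noEdges n) ≡ true
noEdges-isBag n = any-true⁺ _ (listings n) (∈-listings identity identity-injective)
  (all-true⁺ _ (pairs n) λ { {i , j} _ →
    cong (λ b → not b ∨ memPairᵇ (i , j) (consecPairs (toList identity))) (edge-noEdges i j) })
  where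
  identity = Vec.allFin n
  identity-injective : injectiveᵇ identity ≡ true
  identity-injective = injectiveᵇ⁺ identity λ {i} {j} eq →
    trans (sym (Vecₚ.lookup∘tabulate id i)) (trans eq (Vecₚ.lookup∘tabulate id j))

single : Fin n × Fin n → Edges n
single {n} (i , j) = toggle (noEdges n) i j

single-⊆ᴱ : ∀ (E : Edges n) {i j} → edge E i j ≡ true → single (i , j) ⊆ᴱ E
single-⊆ᴱ {n} E {i} {j} inE = toggle-⊆ᴱ (noEdges n) E inE (noEdges-⊆ᴱ E)

single-injective : ∀ {p q : Fin n × Fin n} → single p ≡ single q → p ≡ q
single-injective {n} {i , j} {k , l} eq with (i , j) ≟ᴾ (k , l)
... | yes ij≡kl = ij≡kl
... | no ij≢kl  = contradiction (trans (sym present) (trans (cong (λ U → edge U i j) eq) absent)) λ ()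
  where
  present : edge (single (i , j)) i j ≡ true
  present = trans (edge-toggle-≡ (noEdges n) i j) (cong not (edge-noEdges i j))
  absent : edge (single (k , l)) i j ≡ false
  absent = trans (edge-toggle-≢ (noEdges n) ij≢kl) (edge-noEdges i j)

card≤length-subsetsOf : ∀ (E : Edges n) → card E ≤ length (subsetsOf E)
card≤length-subsetsOf {n} E = subst (_≤ length (subsetsOf E)) (Listₚ.length-map single edgesOfE)
  (Unique-⊆⇒length-≤ (Uniqueₚ.map⁺ single-injective (filterᵇ-unique _ (pairs-unique n))) singles⊆)
  where
  isEdgeOfE : Fin n × Fin n → Bool
  isEdgeOfE (i , j) = edge E i j
  edgesOfE = filterᵇ isEdgeOfE (pairs n)
  singles⊆ : ∀ {U} → U ∈ map single edgesOfE → U ∈ subsetsOf E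
  singles⊆ U∈ with (i , j) , ij∈ , refl ← ∈-map⁻ single U∈ =
    ∈-subsetsOf E (subsetᵇ⁺ (single (i , j)) E
      (single-⊆ᴱ E (proj₂ (∈-filterᵇ⁻ isEdgeOfE (pairs n) ij∈))))

-- Alternating sums of W over subsets

negOnePow-+ : ∀ a b → negOnePow (a ℕ.+ b) ≡ negOnePow a * negOnePow b
negOnePow-+ zero    b = sym (ℤₚ.*-identityˡ _)
negOnePow-+ (suc a) b = trans (cong -_ (negOnePow-+ a b)) (ℤₚ.neg-distribˡ-* (negOnePow a) (negOnePow b))

negOnePow-∸-suc : ∀ {t b} → b < t → negOnePow (t ∸ b) ≡ - negOnePow (t ∸ suc b)
negOnePow-∸-suc {t} {b} b<t = cong negOnePow (ℕₚ.+-∸-assoc 1 b<t)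

sgn : Edges n → Edges n → ℤ
sgn T U = negOnePow (card T ∸ card U)

sgn-refl : ∀ (T : Edges n) → sgn T T ≡ + 1
sgn-refl T = cong negOnePow (ℕₚ.n∸n≡0 (card T))

sgn-trans : ∀ (E T U : Edges n) → card U ≤ card T → card T ≤ card E → sgn E T * sgn T U ≡ sgn E U
sgn-trans E T U U≤T T≤E = begin
  negOnePow (card E ∸ card T) * negOnePow (card T ∸ card U)
    ≡⟨ negOnePow-+ (card E ∸ card T) (card T ∸ card U) ⟨
  negOnePow ((card E ∸ card T) ℕ.+ (card T ∸ card U))
    ≡⟨ cong negOnePow split ⟩
  negOnePow (card E ∸ card U)                               ∎
  where
  split : (card E ∸ card T) ℕ.+ (card T ∸ card U) ≡ card E ∸ card U
  split = trans (sym (ℕₚ.+-∸-assoc (card E ∸ card T) U≤T))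
                (cong (_∸ card U) (ℕₚ.m∸n+n≡m T≤E))

sgn-toggle-absent : ∀ (T U : Edges n) {i j} → edge U i j ≡ false → subsetᵇ (toggle U i j) T ≡ true →
                    sgn T (toggle U i j) ≡ - sgn T U
sgn-toggle-absent T U {i} {j} absent U′⊆T = begin
  negOnePow (card T ∸ card (toggle U i j))
    ≡⟨ cong (λ c → negOnePow (card T ∸ c)) (card-toggle U absent) ⟩
  negOnePow (card T ∸ suc (card U))
    ≡⟨ ℤₚ.neg-involutive _ ⟨
  - - negOnePow (card T ∸ suc (card U))
    ≡⟨ cong -_ (negOnePow-∸-suc U<T) ⟨
  - negOnePow (card T ∸ card U)            ∎
  where
  U<T : card U < card T
  U<T = subst (_≤ card T) (card-toggle U absent)
              (card-mono (toggle U i j) T (subsetᵇ⁻ (toggle U i j) T U′⊆T))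

sgn-toggle : ∀ (T U : Edges n) {i j} → edge T i j ≡ true → subsetᵇ U T ≡ true →
             sgn T (toggle U i j) ≡ - sgn T U
sgn-toggle T U {i} {j} inT U⊆T with edge U i j in inU
... | false = sgn-toggle-absent T U inU (trans (subsetᵇ-toggle U T inT) U⊆T)
... | true  = begin
  sgn T U′                    ≡⟨ ℤₚ.neg-involutive _ ⟨
  - - sgn T U′                ≡⟨ cong -_ (sgn-toggle-absent T U′ U′-absent U″⊆T) ⟨
  - sgn T (toggle U′ i j)     ≡⟨ cong (λ V → - sgn T V) (toggle-involutive U i j) ⟩
  - sgn T U                   ∎
  where
  U′ = toggle U i j
  U′-absent : edge U′ i j ≡ false
  U′-absent = trans (edge-toggle-≡ U i j) (cong not inU)
  U″⊆T : subsetᵇ (toggle U′ i j) T ≡ true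
  U″⊆T = trans (cong (λ V → subsetᵇ V T) (toggle-involutive U i j)) U⊆T

memPairᵇ-self : ∀ {i j : Fin n} xs → (i , j) ∈ xs → memPairᵇ (i , j) xs ≡ true
memPairᵇ-self {n} {i} {j} xs ij∈ = any-true⁺ _ xs ij∈ diagonal
  where
  diagonal : ⌊ i Fin.≟ i ⌋ ∧ ⌊ j Fin.≟ j ⌋ ≡ true
  diagonal with i Fin.≟ i | j Fin.≟ j
  ... | yes _ | yes _ = refl
  ... | no i≢i | _    = contradiction refl i≢i
  ... | yes _ | no j≢j = contradiction refl j≢j

friendlyᵇ-toggle : ∀ (f : Fin n → ℕ) (U : Edges n) (σ : Vec (Fin n) n) {i j} →
                   memPairᵇ (i , j) (consecPairs (toList σ)) ≡ false →
                   friendlyᵇ f (toggle U i j) σ ≡ friendlyᵇ f U σ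
friendlyᵇ-toggle f U σ {i} {j} unlisted = all-cong _ _ (consecPairs (toList σ)) λ { {u , v} uv∈ →
  cong (λ b → if b then f u ℕ.<ᵇ f v else f u ℕ.≤ᵇ f v) (edge-toggle-≢ U (λ { refl →
    contradiction (trans (sym (memPairᵇ-self _ uv∈)) unlisted) λ () })) }

nonBag⇒unlisted-edge : ∀ (T : Edges n) → isBagᵇ T ≡ false → ∀ {σ} → σ ∈ listings n →
  ∃ λ ((i , j) : Fin n × Fin n) → edge T i j ≡ true × memPairᵇ (i , j) (consecPairs (toList σ)) ≡ false
nonBag⇒unlisted-edge {n} T nonBag σ∈
  with (i , j) , _ , unlisted ← all-false⁻ _ (pairs n) (any-false⁻ _ (listings n) nonBag σ∈) =
  (i , j) , split (edge T i j) unlisted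
  where
  split : ∀ a {b} → not a ∨ b ≡ false → a ≡ true × b ≡ false
  split true refl = refl , refl

coeffW-∑ : ∀ (Y : Edges n) f → + coeffW Y f ≡ ∑[ σ ∈ listings n ] 𝟙 (friendlyᵇ f Y σ)
coeffW-∑ {n} Y f = length-filterᵇ (friendlyᵇ f Y) (listings n)

alternating-coeffW-vanishes : ∀ (T : Edges n) → isBagᵇ T ≡ false → ∀ (f : Fin n → ℕ) →
                              ∑[ U ∈ subsetsOf T ] sgn T U * + coeffW U f ≡ + 0
alternating-coeffW-vanishes {n} T nonBag f = begin
  ∑[ U ∈ subsetsOf T ] sgn T U * + coeffW U f
    ≡⟨ ∑-filterᵇ _ (allEdgeSets n) _ ⟩
  ∑[ U ∈ allEdgeSets n ] when (subsetᵇ U T) (sgn T U * + coeffW U f)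
    ≡⟨ ∑-cong′ (allEdgeSets n) expand ⟩
  ∑[ U ∈ allEdgeSets n ] ∑[ σ ∈ listings n ] term σ U
    ≡⟨ ∑-comm (allEdgeSets n) (listings n) _ ⟩
  ∑[ σ ∈ listings n ] ∑[ U ∈ allEdgeSets n ] term σ U
    ≡⟨ ∑-zero (listings n) cancels ⟩
  + 0 ∎
  where
  term : Vec (Fin n) n → Edges n → ℤ
  term σ U = when (subsetᵇ U T) (sgn T U * 𝟙 (friendlyᵇ f U σ))

  expand : ∀ U → when (subsetᵇ U T) (sgn T U * + coeffW U f) ≡ ∑[ σ ∈ listings n ] term σ U
  expand U = begin
    when (subsetᵇ U T) (sgn T U * + coeffW U f)
      ≡⟨ cong (λ c → when (subsetᵇ U T) (sgn T U * c)) (coeffW-∑ U f) ⟩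
    when (subsetᵇ U T) (sgn T U * (∑[ σ ∈ listings n ] 𝟙 (friendlyᵇ f U σ)))
      ≡⟨ cong (when (subsetᵇ U T)) (∑-distribˡ-* (sgn T U) (listings n) _) ⟨
    when (subsetᵇ U T) (∑[ σ ∈ listings n ] sgn T U * 𝟙 (friendlyᵇ f U σ))
      ≡⟨ ∑-when (subsetᵇ U T) (listings n) _ ⟨
    ∑[ σ ∈ listings n ] term σ U ∎

  cancels : ∀ {σ} → σ ∈ listings n → ∑[ U ∈ allEdgeSets n ] term σ U ≡ + 0
  cancels {σ} σ∈ with (i , j) , inT , unlisted ← nonBag⇒unlisted-edge T nonBag σ∈ =
    ∑-sign-reversing-involution _≟ᴱ_ (allEdgeSets-unique n) (λ U → toggle U i j)
      (λ {U} _ → ∈-allEdgeSets (toggle U i j)) (λ {U} _ → toggle-involutive U i j) (term σ) reverses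
    where
    reverses : ∀ {U} → U ∈ allEdgeSets n → term σ (toggle U i j) ≡ - term σ U
    reverses {U} _ = trans
      (cong₂ (λ b c → when b (sgn T (toggle U i j) * 𝟙 c))
             (subsetᵇ-toggle U T inT) (friendlyᵇ-toggle f U σ unlisted))
      (flip (subsetᵇ U T) refl)
      where
      I = 𝟙 (friendlyᵇ f U σ)
      flip : ∀ b → subsetᵇ U T ≡ b → when b (sgn T (toggle U i j) * I) ≡ - when b (sgn T U * I)
      flip false _   = refl
      flip true  U⊆T = trans (cong (_* I) (sgn-toggle T U inT U⊆T)) (sym (ℤₚ.neg-distribˡ-* (sgn T U) I))

-- Chains in the edge poset

ltᵇ⇒strictSubsetᵇ : ∀ (U T : Edges n) → ltᵇ U T ≡ true → strictSubsetᵇ U T ≡ true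
ltᵇ⇒strictSubsetᵇ U T U<T with strictSubsetᵇ U T | U<T
... | true | _ = refl

ltᵇ-bag : ∀ (U T : Edges n) → isBagᵇ T ≡ true → ltᵇ U T ≡ false
ltᵇ-bag U T bag rewrite bag = Boolₚ.∧-zeroʳ _

ltᵇ-nonBag : ∀ (U T : Edges n) → isBagᵇ T ≡ false → ltᵇ U T ≡ strictSubsetᵇ U T
ltᵇ-nonBag U T nonBag rewrite nonBag = Boolₚ.∧-identityʳ _

minimal⇔bag : ∀ (E S : Edges n) → all (λ T → not (ltᵇ T S)) (subsetsOf E) ≡ isBagᵇ S
minimal⇔bag {n} E S = by-cases (isBagᵇ S) refl
  where
  by-cases : ∀ b → isBagᵇ S ≡ b → all (λ T → not (ltᵇ T S)) (subsetsOf E) ≡ isBagᵇ S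
  by-cases true  bag = trans (all-true⁺ _ (subsetsOf E) (λ {T} _ → cong not (ltᵇ-bag T S bag))) (sym bag)
  by-cases false bag = trans (all-false⁺ _ (subsetsOf E) noEdges∈ (cong not noEdges<S)) (sym bag)
    where
    noEdges≢S : noEdges n ≢ S
    noEdges≢S eq = contradiction (trans (sym (noEdges-isBag n)) (trans (cong isBagᵇ eq) bag)) λ ()
    noEdges⊊S : strictSubsetᵇ (noEdges n) S ≡ true
    noEdges⊊S with noEdges n ≟ᴱ S
    ... | yes eq = contradiction eq noEdges≢S
    ... | no _   = trans (Boolₚ.∧-identityʳ _) (subsetᵇ⁺ (noEdges n) S (noEdges-⊆ᴱ S))
    noEdges<S : ltᵇ (noEdges n) S ≡ true
    noEdges<S = trans (ltᵇ-nonBag (noEdges n) S bag) noEdges⊊S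
    noEdges∈ : noEdges n ∈ subsetsOf E
    noEdges∈ = ∈-subsetsOf E (subsetᵇ⁺ (noEdges n) E (noEdges-⊆ᴱ E))

-- Elements of a chain have strictly increasing numbers of edges.
chainCount-vanishes : ∀ (E : Edges n) k T → card E < card T ℕ.+ k → chainCount E k T ≡ 0
chainCount-vanishes E zero T E<T with T ≟ᴱ E
... | yes refl = contradiction (subst (card T <_) (ℕₚ.+-identityʳ (card T)) E<T) (ℕₚ.<-irrefl refl)
... | no _     = refl
chainCount-vanishes E (suc k) T E<T+k+1 = ℤₚ.+-injective (begin
  + chainCount E (suc k) T
    ≡⟨ sumℕ-∑ _ (filterᵇ (ltᵇ T) (subsetsOf E)) ⟩
  ∑[ U ∈ filterᵇ (ltᵇ T) (subsetsOf E) ] + chainCount E k U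
    ≡⟨ ∑-zero _ vanishes ⟩
  + 0                                                         ∎)
  where
  vanishes : ∀ {U} → U ∈ filterᵇ (ltᵇ T) (subsetsOf E) → + chainCount E k U ≡ + 0
  vanishes {U} U∈ = cong +_ (chainCount-vanishes E k U (ℕₚ.<-≤-trans E<T+k+1
    (subst (_≤ card U ℕ.+ k) (sym (ℕₚ.+-suc (card T) k)) (ℕₚ.+-monoˡ-≤ k T<U))))
    where
    T<U = card-strict T U (ltᵇ⇒strictSubsetᵇ T U (proj₂ (∈-filterᵇ⁻ (ltᵇ T) (subsetsOf E) U∈)))

-- After k rounds of replacing Ψ T, for the non-bags T ⊆ E, by minus the alternating sum of Ψ over the proper
-- subsets of T, Ψ E = Σ_{j<k} bagWeight j + chainWeight k: chainWeight k runs over the lower ends of the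
-- chains of length k up to E, and bagWeight k is its part at bags.
module Unrolling {n} (E : Edges n) (Ψ : Edges n → ℤ)
  (vanishes : ∀ T → subsetᵇ T E ≡ true → isBagᵇ T ≡ false →
              ∑[ U ∈ subsetsOf T ] sgn T U * Ψ U ≡ + 0) where

  𝒮 : List (Edges n)
  𝒮 = subsetsOf E

  signedChains : ℕ → Edges n → ℤ
  signedChains k T = negOnePow k * + chainCount E k T

  chainWeight : ℕ → ℤ
  chainWeight k = ∑[ T ∈ 𝒮 ] sgn E T * signedChains k T * Ψ T

  bagWeight : ℕ → ℤ
  bagWeight k = ∑[ T ∈ 𝒮 ] when (isBagᵇ T) (sgn E T * signedChains k T * Ψ T)

  Ψ-nonBag : ∀ T → subsetᵇ T E ≡ true → isBagᵇ T ≡ false →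
             Ψ T ≡ - (∑[ U ∈ 𝒮 ] when (strictSubsetᵇ U T) (sgn T U * Ψ U))
  Ψ-nonBag T T⊆E nonBag = sum≡0⇒≡neg below (Ψ T) (sym decompose)
    where
    x : Edges n → ℤ
    x U = sgn T U * Ψ U
    below = ∑[ U ∈ 𝒮 ] when (strictSubsetᵇ U T) (x U)
    decompose : + 0 ≡ below + Ψ T
    decompose = begin
      + 0
        ≡⟨ vanishes T T⊆E nonBag ⟨
      ∑[ U ∈ subsetsOf T ] x U
        ≡⟨ ∑-subsetsOf-⊆ T E T⊆E x ⟩
      ∑[ U ∈ 𝒮 ] when (subsetᵇ U T) (x U)
        ≡⟨ ∑-cong′ 𝒮 (λ U → split-when-≡ (subsetᵇ U T) (eqEdges U T) (x U) (equal⇒subset U)) ⟩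
      ∑[ U ∈ 𝒮 ] (when (strictSubsetᵇ U T) (x U) + when ⌊ U ≟ᴱ T ⌋ (x U))
        ≡⟨ ∑-distrib-+ 𝒮 _ _ ⟩
      below + (∑[ U ∈ 𝒮 ] when ⌊ U ≟ᴱ T ⌋ (x U))
        ≡⟨ cong (_+_ below) (∑-δ _≟ᴱ_ (subsetsOf-unique E) x (∈-subsetsOf E T⊆E)) ⟩
      below + sgn T T * Ψ T
        ≡⟨ cong (λ s → below + s * Ψ T) (sgn-refl T) ⟩
      below + + 1 * Ψ T
        ≡⟨ cong (_+_ below) (ℤₚ.*-identityˡ (Ψ T)) ⟩
      below + Ψ T ∎
      where
      equal⇒subset : ∀ U → eqEdges U T ≡ true → subsetᵇ U T ≡ true
      equal⇒subset U eq with U ≟ᴱ T | eq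
      ... | yes refl | _ = subsetᵇ-refl U

  chainCount-suc : ∀ k U → + chainCount E (suc k) U ≡ ∑[ T ∈ 𝒮 ] when (ltᵇ U T) (+ chainCount E k T)
  chainCount-suc k U = trans (sumℕ-∑ (chainCount E k) (filterᵇ (ltᵇ U) 𝒮)) (∑-filterᵇ (ltᵇ U) 𝒮 _)

  nonBag-expand : ∀ k {T} → T ∈ 𝒮 →
    when (not (isBagᵇ T)) (sgn E T * signedChains k T * Ψ T)
      ≡ ∑[ U ∈ 𝒮 ] when (ltᵇ U T) (- (sgn E T * signedChains k T * (sgn T U * Ψ U)))
  nonBag-expand k {T} T∈ = by-cases (isBagᵇ T) refl
    where
    c = sgn E T * signedChains k T
    x : Edges n → ℤ
    x U = sgn T U * Ψ U
    by-cases : ∀ b → isBagᵇ T ≡ b →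
               when (not b) (c * Ψ T) ≡ ∑[ U ∈ 𝒮 ] when (ltᵇ U T) (- (c * x U))
    by-cases true bag = sym (∑-zero 𝒮 (λ {U} _ → cong (λ b → when b (- (c * x U))) (ltᵇ-bag U T bag)))
    by-cases false nonBag = begin
      c * Ψ T
        ≡⟨ cong (c *_) (Ψ-nonBag T (∈-subsetsOf⁻ E T∈) nonBag) ⟩
      c * - (∑[ U ∈ 𝒮 ] when (strictSubsetᵇ U T) (x U))
        ≡⟨ ℤₚ.neg-distribʳ-* c _ ⟨
      - (c * (∑[ U ∈ 𝒮 ] when (strictSubsetᵇ U T) (x U)))
        ≡⟨ cong -_ (∑-distribˡ-* c 𝒮 _) ⟨
      - (∑[ U ∈ 𝒮 ] c * when (strictSubsetᵇ U T) (x U))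
        ≡⟨ ∑-neg 𝒮 _ ⟨
      ∑[ U ∈ 𝒮 ] - (c * when (strictSubsetᵇ U T) (x U))
        ≡⟨ ∑-cong′ 𝒮 (λ U → trans (push-neg (strictSubsetᵇ U T) (x U))
                                   (cong (λ b → when b (- (c * x U))) (sym (ltᵇ-nonBag U T nonBag)))) ⟩
      ∑[ U ∈ 𝒮 ] when (ltᵇ U T) (- (c * x U)) ∎
      where
      push-neg : ∀ b y → - (c * when b y) ≡ when b (- (c * y))
      push-neg true  y = refl
      push-neg false y = cong -_ (ℤₚ.*-zeroʳ c)

  column : ∀ k {U} → U ∈ 𝒮 →
           ∑[ T ∈ 𝒮 ] when (ltᵇ U T) (- (sgn E T * signedChains k T * (sgn T U * Ψ U)))
             ≡ sgn E U * signedChains (suc k) U * Ψ U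
  column k {U} U∈ = begin
    ∑[ T ∈ 𝒮 ] when (ltᵇ U T) (- (sgn E T * signedChains k T * (sgn T U * Ψ U)))
      ≡⟨ ∑-cong 𝒮 (λ {T} T∈ → pointwise T (ltᵇ U T) refl T∈) ⟩
    ∑[ T ∈ 𝒮 ] c * when (ltᵇ U T) (+ chainCount E k T)
      ≡⟨ ∑-distribˡ-* c 𝒮 _ ⟩
    c * (∑[ T ∈ 𝒮 ] when (ltᵇ U T) (+ chainCount E k T))
      ≡⟨ cong (c *_) (chainCount-suc k U) ⟨
    c * + chainCount E (suc k) U
      ≡⟨ reassociate (sgn E U) (negOnePow (suc k)) (Ψ U) (+ chainCount E (suc k) U) ⟩
    sgn E U * signedChains (suc k) U * Ψ U ∎
    where
    c = sgn E U * negOnePow (suc k) * Ψ U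
    reassociate : ∀ s m p a → s * m * p * a ≡ s * (m * a) * p
    reassociate = solve-∀
    regroup : ∀ s e m a p → - (s * (m * a) * (e * p)) ≡ s * e * - m * p * a
    regroup = solve-∀
    pointwise : ∀ T b → ltᵇ U T ≡ b → T ∈ 𝒮 →
                when b (- (sgn E T * signedChains k T * (sgn T U * Ψ U))) ≡ c * when b (+ chainCount E k T)
    pointwise T false _   _  = sym (ℤₚ.*-zeroʳ c)
    pointwise T true  U<T T∈ = begin
      - (sgn E T * (negOnePow k * a) * (sgn T U * Ψ U))
        ≡⟨ regroup (sgn E T) (sgn T U) (negOnePow k) a (Ψ U) ⟩
      sgn E T * sgn T U * - negOnePow k * Ψ U * a
        ≡⟨ cong (λ s → s * - negOnePow k * Ψ U * a) (sgn-trans E T U U≤T T≤E) ⟩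
      c * a ∎
      where
      a = + chainCount E k T
      U≤T = ℕₚ.<⇒≤ (card-strict U T (ltᵇ⇒strictSubsetᵇ U T U<T))
      T≤E = card-mono T E (subsetᵇ⁻ T E (∈-subsetsOf⁻ E T∈))

  chainWeight-step : ∀ k → chainWeight k ≡ bagWeight k + chainWeight (suc k)
  chainWeight-step k = begin
    chainWeight k
      ≡⟨ ∑-cong′ 𝒮 (λ T → split-when-not (isBagᵇ T) (y T)) ⟩
    ∑[ T ∈ 𝒮 ] (when (isBagᵇ T) (y T) + when (not (isBagᵇ T)) (y T))
      ≡⟨ ∑-distrib-+ 𝒮 _ _ ⟩
    bagWeight k + (∑[ T ∈ 𝒮 ] when (not (isBagᵇ T)) (y T))
      ≡⟨ cong (_+_ (bagWeight k)) (∑-cong 𝒮 (nonBag-expand k)) ⟩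
    bagWeight k + (∑[ T ∈ 𝒮 ] ∑[ U ∈ 𝒮 ] when (ltᵇ U T) (z T U))
      ≡⟨ cong (_+_ (bagWeight k)) (∑-comm 𝒮 𝒮 _) ⟩
    bagWeight k + (∑[ U ∈ 𝒮 ] ∑[ T ∈ 𝒮 ] when (ltᵇ U T) (z T U))
      ≡⟨ cong (_+_ (bagWeight k)) (∑-cong 𝒮 (column k)) ⟩
    bagWeight k + chainWeight (suc k) ∎
    where
    y : Edges n → ℤ
    y T = sgn E T * signedChains k T * Ψ T
    z : Edges n → Edges n → ℤ
    z T U = - (sgn E T * signedChains k T * (sgn T U * Ψ U))

  chainWeight-zero : chainWeight 0 ≡ Ψ E
  chainWeight-zero = begin
    chainWeight 0
      ≡⟨ ∑-cong′ 𝒮 pointwise ⟩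
    ∑[ T ∈ 𝒮 ] when ⌊ T ≟ᴱ E ⌋ (sgn E T * Ψ T)
      ≡⟨ ∑-δ _≟ᴱ_ (subsetsOf-unique E) _ (∈-subsetsOf E (subsetᵇ-refl E)) ⟩
    sgn E E * Ψ E
      ≡⟨ cong (_* Ψ E) (sgn-refl E) ⟩
    + 1 * Ψ E
      ≡⟨ ℤₚ.*-identityˡ (Ψ E) ⟩
    Ψ E                                          ∎
    where
    pointwise : ∀ T → sgn E T * signedChains 0 T * Ψ T ≡ when ⌊ T ≟ᴱ E ⌋ (sgn E T * Ψ T)
    pointwise T with T ≟ᴱ E
    ... | yes _ = cong (_* Ψ T) (ℤₚ.*-identityʳ (sgn E T))
    ... | no _  = trans (cong (_* Ψ T) (ℤₚ.*-zeroʳ (sgn E T))) (ℤₚ.*-zeroˡ (Ψ T))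

  -- ξ E sums over the chain lengths below N.
  N : ℕ
  N = suc (length 𝒮)

  chainWeight-vanishes : chainWeight N ≡ + 0
  chainWeight-vanishes = ∑-zero 𝒮 pointwise
    where
    annihilate : ∀ s m p → s * (m * + 0) * p ≡ + 0
    annihilate = solve-∀
    E<T+N : ∀ T → card E < card T ℕ.+ N
    E<T+N T = ℕₚ.≤-trans (s≤s (card≤length-subsetsOf E)) (ℕₚ.m≤n+m N (card T))
    pointwise : ∀ {T} → T ∈ 𝒮 → sgn E T * signedChains N T * Ψ T ≡ + 0
    pointwise {T} _ rewrite chainCount-vanishes E N T (E<T+N T) = annihilate (sgn E T) (negOnePow N) (Ψ T)

  bagWeights : ∑ (upTo N) bagWeight ≡ ∑[ S ∈ minimals E ] sgn E S * ξ E S * Ψ S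
  bagWeights = begin
    ∑ (upTo N) bagWeight
      ≡⟨ ∑-comm (upTo N) 𝒮 _ ⟩
    ∑[ T ∈ 𝒮 ] ∑[ k ∈ upTo N ] when (isBagᵇ T) (sgn E T * signedChains k T * Ψ T)
      ≡⟨ ∑-cong′ 𝒮 (λ T → trans (∑-when (isBagᵇ T) (upTo N) _) (cong (when (isBagᵇ T)) (factor T))) ⟩
    ∑[ T ∈ 𝒮 ] when (isBagᵇ T) (sgn E T * ξ E T * Ψ T)
      ≡⟨ ∑-cong′ 𝒮 (λ T → cong (λ b → when b (sgn E T * ξ E T * Ψ T)) (sym (minimal⇔bag E T))) ⟩
    ∑[ T ∈ 𝒮 ] when (all (λ U → not (ltᵇ U T)) 𝒮) (sgn E T * ξ E T * Ψ T)
      ≡⟨ ∑-filterᵇ _ 𝒮 _ ⟨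
    ∑[ S ∈ minimals E ] sgn E S * ξ E S * Ψ S ∎
    where
    factor : ∀ T → ∑[ k ∈ upTo N ] sgn E T * signedChains k T * Ψ T ≡ sgn E T * ξ E T * Ψ T
    factor T = begin
      ∑[ k ∈ upTo N ] sgn E T * signedChains k T * Ψ T
        ≡⟨ ∑-distribʳ-* (Ψ T) (upTo N) (λ k → sgn E T * signedChains k T) ⟩
      (∑[ k ∈ upTo N ] sgn E T * signedChains k T) * Ψ T
        ≡⟨ cong (_* Ψ T) (∑-distribˡ-* (sgn E T) (upTo N) (λ k → signedChains k T)) ⟩
      sgn E T * ξ E T * Ψ T ∎

  unroll : Ψ E ≡ ∑[ S ∈ minimals E ] sgn E S * ξ E S * Ψ S
  unroll = begin
    Ψ E                                   ≡⟨ chainWeight-zero ⟨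
    chainWeight 0                         ≡⟨ telescope chainWeight bagWeight chainWeight-step N ⟩
    ∑ (upTo N) bagWeight + chainWeight N  ≡⟨ cong (_+_ (∑ (upTo N) bagWeight)) chainWeight-vanishes ⟩
    ∑ (upTo N) bagWeight + + 0            ≡⟨ ℤₚ.+-identityʳ _ ⟩
    ∑ (upTo N) bagWeight                  ≡⟨ bagWeights ⟩
    ∑[ S ∈ minimals E ] sgn E S * ξ E S * Ψ S ∎

-- Relabelling vertices

friendlyᵇ-cong : ∀ {f f′ : Fin n → ℕ} (Y : Edges n) σ → (∀ i → f i ≡ f′ i) →
                 friendlyᵇ f Y σ ≡ friendlyᵇ f′ Y σ
friendlyᵇ-cong Y σ f≗f′ = all-cong _ _ (consecPairs (toList σ)) λ { {u , v} _ →
  cong₂ (λ x y → if edge Y u v then x ℕ.<ᵇ y else x ℕ.≤ᵇ y) (f≗f′ u) (f≗f′ v) }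

coeffW-cong : ∀ (Y : Edges n) {f f′} → (∀ i → f i ≡ f′ i) → coeffW Y f ≡ coeffW Y f′
coeffW-cong {n} Y {f} {f′} f≗f′ = ℤₚ.+-injective (begin
  + coeffW Y f
    ≡⟨ coeffW-∑ Y f ⟩
  ∑[ σ ∈ listings n ] 𝟙 (friendlyᵇ f Y σ)
    ≡⟨ ∑-cong′ (listings n) (λ σ → cong 𝟙 (friendlyᵇ-cong Y σ f≗f′)) ⟩
  ∑[ σ ∈ listings n ] 𝟙 (friendlyᵇ f′ Y σ)
    ≡⟨ coeffW-∑ Y f′ ⟨
  + coeffW Y f′                                 ∎)

module Relabelling {n} (S P : Edges n) (p : Fin n → Fin n) (p-injective : Injective _≡_ _≡_ p)
  (preserves : ∀ i j → edge S i j ≡ edge P (p i) (p j)) where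

  p⁻¹ : Fin n → Fin n
  p⁻¹ y = proj₁ (injective⇒surjective p-injective y)

  p∘p⁻¹ : ∀ y → p (p⁻¹ y) ≡ y
  p∘p⁻¹ y = proj₂ (injective⇒surjective p-injective y)

  p⁻¹∘p : ∀ x → p⁻¹ (p x) ≡ x
  p⁻¹∘p x = p-injective (p∘p⁻¹ (p x))

  p⁻¹-injective : Injective _≡_ _≡_ p⁻¹
  p⁻¹-injective {i} {j} eq = trans (sym (p∘p⁻¹ i)) (trans (cong p eq) (p∘p⁻¹ j))

  friendlyᵇ-relabel : ∀ (g : Fin n → ℕ) σ → friendlyᵇ (g ∘ p) S σ ≡ friendlyᵇ g P (Vec.map p σ)
  friendlyᵇ-relabel g σ = begin
    all step-S (consecPairs (toList σ))
      ≡⟨ all-cong _ _ (consecPairs (toList σ)) (λ { {u , v} _ →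
           cong (λ b → if b then g (p u) ℕ.<ᵇ g (p v) else g (p u) ℕ.≤ᵇ g (p v)) (preserves u v) }) ⟩
    all (step-P ∘ (λ (u , v) → p u , p v)) (consecPairs (toList σ))
      ≡⟨ cong Data.Bool.ListAction.and (Listₚ.map-∘ (consecPairs (toList σ))) ⟩
    all step-P (map (λ (u , v) → p u , p v) (consecPairs (toList σ)))
      ≡⟨ cong (all step-P) (consecPairs-map p (toList σ)) ⟨
    all step-P (consecPairs (map p (toList σ)))
      ≡⟨ cong (all step-P ∘ consecPairs) (Vecₚ.toList-map p σ) ⟨
    all step-P (consecPairs (toList (Vec.map p σ))) ∎
    where
    step-S step-P : Fin n × Fin n → Bool
    step-S (u , v) = if edge S u v then g (p u) ℕ.<ᵇ g (p v) else g (p u) ℕ.≤ᵇ g (p v)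
    step-P (u , v) = if edge P u v then g u ℕ.<ᵇ g v else g u ℕ.≤ᵇ g v

  coeffW-relabel : ∀ (g : Fin n → ℕ) → coeffW S (g ∘ p) ≡ coeffW P g
  coeffW-relabel g = ℤₚ.+-injective (begin
    + coeffW S (g ∘ p)
      ≡⟨ coeffW-∑ S (g ∘ p) ⟩
    ∑[ σ ∈ listings n ] 𝟙 (friendlyᵇ (g ∘ p) S σ)
      ≡⟨ ∑-cong′ (listings n) (cong 𝟙 ∘ friendlyᵇ-relabel g) ⟩
    ∑[ σ ∈ listings n ] 𝟙 (friendlyᵇ g P (Vec.map p σ))
      ≡⟨ relabel-listings (λ σ → 𝟙 (friendlyᵇ g P σ)) ⟩
    ∑[ σ ∈ listings n ] 𝟙 (friendlyᵇ g P σ)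
      ≡⟨ coeffW-∑ P g ⟨
    + coeffW P g                                             ∎)
    where
    relabel-listings : ∀ h → ∑[ σ ∈ listings n ] h (Vec.map p σ) ≡ ∑ (listings n) h
    relabel-listings = ∑-reindex (Vecₚ.≡-dec Fin._≟_) (listings-unique n) (Vec.map p) (Vec.map p⁻¹)
      (λ {σ} → ∈-listings-∘ p id p-injective id (λ i → Vecₚ.lookup-map i p σ))
      (λ {σ} → ∈-listings-∘ p⁻¹ id p⁻¹-injective id (λ i → Vecₚ.lookup-map i p⁻¹ σ))
      (λ {σ} _ → map-inverse p p⁻¹ p⁻¹∘p σ) (λ {σ} _ → map-inverse p⁻¹ p p∘p⁻¹ σ)

  coeffU-relabel : ∀ (a : Vec ℕ n) → coeffU S a ≡ coeffU P a
  coeffU-relabel a = ℤₚ.+-injective (begin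
    + coeffU S a
      ≡⟨ sumℕ-∑ _ R ⟩
    ∑[ w ∈ R ] + coeffW S (lookup w)
      ≡⟨ ∑-cong′ R (λ w → cong +_ (relabelled w)) ⟩
    ∑[ w ∈ R ] + coeffW P (lookup (permute p⁻¹ w))
      ≡⟨ relabel-words (λ w → + coeffW P (lookup w)) ⟩
    ∑[ w ∈ R ] + coeffW P (lookup w)
      ≡⟨ sumℕ-∑ _ R ⟨
    + coeffU P a                                       ∎)
    where
    R = rearrangements a
    relabelled : ∀ w → coeffW S (lookup w) ≡ coeffW P (lookup (permute p⁻¹ w))
    relabelled w = trans (coeffW-cong S λ i → trans (cong (lookup w) (sym (p⁻¹∘p i)))
                                                     (sym (lookup-permute p⁻¹ w (p i))))
                         (coeffW-relabel (lookup (permute p⁻¹ w)))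
    relabel-words : ∀ h → ∑[ w ∈ R ] h (permute p⁻¹ w) ≡ ∑ R h
    relabel-words = ∑-reindex (Vecₚ.≡-dec ℕ._≟_) (deduplicate-! (Vecₚ.≡-dec ℕ._≟_) _)
      (permute p⁻¹) (permute p)
      (∈-rearrangements-permute a p⁻¹ p⁻¹-injective) (∈-rearrangements-permute a p p-injective)
      (λ {w} _ → permute-inverse p⁻¹ p p⁻¹∘p w) (λ {w} _ → permute-inverse p p⁻¹ p∘p⁻¹ w)

coeffU-iso : ∀ (S P : Edges n) → Iso S P → ∀ a → coeffU S a ≡ coeffU P a
coeffU-iso S P (π , π-injective , preserves) =
  Relabelling.coeffU-relabel S P (lookup π) (injectiveᵇ⁻ π (T⇒≡true π-injective)) preserves

coeffW-expansion⇒coeffU-expansion :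
  ∀ (E : Edges n) (Ss : List (Edges n)) (c : Edges n → ℤ) →
  (∀ f → + coeffW E f ≡ ∑[ S ∈ Ss ] c S * + coeffW S f) →
  ∀ a → + coeffU E a ≡ ∑[ S ∈ Ss ] c S * + coeffU S a
coeffW-expansion⇒coeffU-expansion E Ss c expansion a = begin
  + coeffU E a                                         ≡⟨ sumℕ-∑ _ R ⟩
  ∑[ w ∈ R ] + coeffW E (lookup w)                      ≡⟨ ∑-cong′ R (expansion ∘ lookup) ⟩
  ∑[ w ∈ R ] ∑[ S ∈ Ss ] c S * + coeffW S (lookup w)    ≡⟨ ∑-comm R Ss _ ⟩
  ∑[ S ∈ Ss ] ∑[ w ∈ R ] c S * + coeffW S (lookup w)    ≡⟨ ∑-cong′ Ss factor ⟩
  ∑[ S ∈ Ss ] c S * + coeffU S a                        ∎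
  where
  R = rearrangements a
  factor : ∀ S → ∑[ w ∈ R ] c S * + coeffW S (lookup w) ≡ c S * + coeffU S a
  factor S = trans (∑-distribˡ-* (c S) R (λ w → + coeffW S (lookup w)))
                   (cong (c S *_) (sym (sumℕ-∑ (λ w → coeffW S (lookup w)) R)))

mainTheorem17 : (n : ℕ) (E : Edges n) → isBagᵇ E ≡ false →
    ((f : Fin n → ℕ) →
      + coeffW E f
        ≡ sumℤ (map (λ S → negOnePow (card E ∸ card S) * ξ E S * + coeffW S f) (minimals E)))
    × ((lam : Edges n → List ℕ) →
       (∀ S → S ∈ minimals E → IsPartition n (lam S) × Iso S (sticks n (lam S))) →
       (a : Vec ℕ n) →
      + coeffU E a
        ≡ sumℤ (map (λ S → negOnePow (card E ∸ card S) * ξ E S * + coeffU (sticks n (lam S)) a) (minimals E)))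
mainTheorem17 n E _ = coeffW-expansion , coeffU-expansion
  where
  coeffW-expansion : ∀ f → + coeffW E f ≡ ∑[ S ∈ minimals E ] sgn E S * ξ E S * + coeffW S f
  coeffW-expansion f = Unrolling.unroll E (λ U → + coeffW U f)
                         (λ T _ nonBag → alternating-coeffW-vanishes T nonBag f)

  coeffU-expansion : ∀ lam → (∀ S → S ∈ minimals E → IsPartition n (lam S) × Iso S (sticks n (lam S))) →
                     ∀ a → + coeffU E a ≡ ∑[ S ∈ minimals E ] sgn E S * ξ E S * + coeffU (sticks n (lam S)) a
  coeffU-expansion lam sticks-iso a =
    trans (coeffW-expansion⇒coeffU-expansion E (minimals E) (λ S → sgn E S * ξ E S) coeffW-expansion a)
          (∑-cong (minimals E) λ {S} S∈ →
            cong (λ k → sgn E S * ξ E S * + k) (coeffU-iso S (sticks n (lam S)) (proj₂ (sticks-iso S S∈)) a))
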